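{- Let $k\geq 3$ be an odd integer and let $p$ be a prime with $p\equiv 1 \pmod{4k}$. Then there are no integers $x,y,z$ (positive, negative or zero) satisfying $x^2+y^2+z^k=p^{k}$ and $z\equiv 2k \pmod{4k}$. -}

module Defs where

{-# OPTIONS --safe #-}
module Submission where

-- Write x² + y² = pᵏ − zᵏ = (p − z)·G with G = Σ pⁱ z^(k−1−i). The congruences give
-- p − z ≡ 3 (mod 4) and p − z ≡ 1 (mod k), and p − z > 0 since otherwise zᵏ > pᵏ.
-- A sum of two squares X² + Y² = D·M with D ≡ 3 (mod 4) forces a prime q ≡ 3 (mod 4)
-- dividing both D and M: some such q divides D, by Fermat it divides X and Y, and
-- q² can be cancelled until q divides M. But a common prime of p − z and G divides
-- G − k zᵏ⁻¹ and hence k zᵏ⁻¹; it cannot divide k as p − z ≡ 1 (mod k), and if it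
-- divides z it divides p, so q = p ≡ 1 (mod 4).

open import Defs
open import Data.Nat using (ℕ; _≥_; _%_) renaming (_*_ to _*ℕ_)
open import Data.Nat.Primality using (Prime)
open import Data.Integer using (ℤ; +_; _+_; _-_; _*_; _^_)
open import Data.Integer.Divisibility using (_∣_)
open import Data.Product using (Σ; _×_)
open import Relation.Nullary using (¬_)
open import Relation.Binary.PropositionalEquality using (_≡_)

open import Data.Nat using (zero; suc; _<_; _≤_; _∸_; _/_; _!; NonZero; nonTrivial⇒n>1; s≤s; z<s; s<s)
  renaming (_+_ to _+ℕ_; _^_ to _^ℕ_)
import Data.Nat.Properties as ℕ
open import Data.Nat.DivMod using (m≡m%n+[m/n]*n; [m+kn]%n≡m%n; m<n⇒m%n≡m; m%n<n; %-distribˡ-*; m%n%n≡m%n; m*[n/m]≡n)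
open import Data.Nat.Divisibility using (divides; _∣0; ∣-trans; ∣1⇒≡1; ∣⇒≤; m∣m*n; n∣m*n; ∣m∣n⇒∣m+n; ∣m⇒∣m*n)
  renaming (_∣_ to _∣ℕ_)
open import Data.Nat.Primality using (euclidsLemma; prime⇒nonZero; prime⇒nonTrivial; prime⇒irreducible; ¬prime[1])
open import Data.Nat.Primality.Factorisation using (factorise; PrimeFactorisation)
open import Data.Nat.Combinatorics using (_C_; nCn≡1; k![n∸k]!∣n!)
open import Data.Nat.Combinatorics.Specification using (nCk≡n!/k![n-k]!)
open import Data.Nat.ListAction using (product)
open import Data.Nat.Induction using (<-rec)
import Data.Nat.Tactic.RingSolver as ℕ-Solver
open import Data.Integer using (-[1+_]; ∣_∣; -_)
import Data.Integer.Properties as ℤ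
open import Data.Integer.Divisibility.Signed as ℤ∣ using (divides; ∣ᵤ⇒∣; ∣⇒∣ᵤ)
  renaming (_∣_ to _∣ℤ_)
open import Data.Integer.Tactic.RingSolver using (solve-∀)
open import Data.Fin using (Fin; zero; suc; toℕ; inject₁; fromℕ)
open import Data.Fin.Properties using (toℕ-inject₁; toℕ-fromℕ; toℕ<n)
open import Data.Vec.Functional using (Vector; tail)
open import Data.List using (_∷_)
open import Data.List.Relation.Unary.All using (All; _∷_)
open import Data.Product using (∃-syntax; _,_; proj₁; proj₂)
open import Data.Sum using (_⊎_; inj₁; inj₂; [_,_]′; map₂)
open import Function using (_∘_)
open import Relation.Nullary using (contradiction)
open import Relation.Binary.PropositionalEquality using (_≢_; refl; sym; trans; cong; cong₂; subst; module ≡-Reasoning)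
open import Algebra.Properties.CommutativeSemigroup ℕ.*-commutativeSemigroup using (xy∙z≈y∙xz)
open import Algebra.Properties.CommutativeSemiring.Binomial ℕ.+-*-commutativeSemiring using (binomialTerm; theorem)
open import Algebra.Properties.Semiring.Exp ℕ.+-*-semiring using () renaming (_^_ to _^ˢ_)
open import Algebra.Properties.Semiring.Sum ℕ.+-*-semiring using (sum; sum-init-last; sum-cong-≗)
open import Algebra.Properties.Semiring.Mult ℕ.+-*-semiring using () renaming (_×_ to _×ₘ_)

open ≡-Reasoning

pos-^ : ∀ a n → + (a ^ℕ n) ≡ (+ a) ^ n
pos-^ a zero    = refl
pos-^ a (suc n) = trans (ℤ.pos-* a (a ^ℕ n)) (cong (+ a *_) (pos-^ a n))

abs-^ : ∀ z n → ∣ z ^ n ∣ ≡ ∣ z ∣ ^ℕ n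
abs-^ z zero    = refl
abs-^ z (suc n) = trans (ℤ.abs-* z (z ^ n)) (cong (∣ z ∣ *ℕ_) (abs-^ z n))

^2≡+∣∣^2 : ∀ x → x ^ 2 ≡ + (∣ x ∣ ^ℕ 2)
^2≡+∣∣^2 (+ n)    = sym (pos-^ n 2)
^2≡+∣∣^2 -[1+ n ] = sym (pos-^ (suc n) 2)

+[∣x∣²+∣y∣²]≡x²+y² : ∀ x y → + (∣ x ∣ ^ℕ 2 +ℕ ∣ y ∣ ^ℕ 2) ≡ x ^ 2 + y ^ 2
+[∣x∣²+∣y∣²]≡x²+y² x y = trans (ℤ.pos-+ (∣ x ∣ ^ℕ 2) (∣ y ∣ ^ℕ 2)) (sym (cong₂ _+_ (^2≡+∣∣^2 x) (^2≡+∣∣^2 y)))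

-- Geometric sums

geometricSum : ℕ → ℤ → ℤ → ℤ
geometricSum zero    a b = + 0
geometricSum (suc n) a b = a ^ n + b * geometricSum n a b

[a-b]*geometricSum≡aⁿ-bⁿ : ∀ n a b → (a - b) * geometricSum n a b ≡ a ^ n - b ^ n
[a-b]*geometricSum≡aⁿ-bⁿ zero    a b = ℤ.*-zeroʳ (a - b)
[a-b]*geometricSum≡aⁿ-bⁿ (suc n) a b = begin
  (a - b) * (a ^ n + b * G)             ≡⟨ distribute a b (a ^ n) G ⟩
  (a - b) * a ^ n + b * ((a - b) * G)   ≡⟨ cong (λ t → (a - b) * a ^ n + b * t) ([a-b]*geometricSum≡aⁿ-bⁿ n a b) ⟩
  (a - b) * a ^ n + b * (a ^ n - b ^ n) ≡⟨ collect a b (a ^ n) (b ^ n) ⟩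
  a * a ^ n - b * b ^ n                 ∎
  where
  G = geometricSum n a b
  distribute : ∀ a b A g → (a - b) * (A + b * g) ≡ (a - b) * A + b * ((a - b) * g)
  distribute = solve-∀
  collect : ∀ a b A B → (a - b) * A + b * (A - B) ≡ a * A - b * B
  collect = solve-∀

a-b∣aⁿ-bⁿ : ∀ n a b → (a - b) ∣ℤ a ^ n - b ^ n
a-b∣aⁿ-bⁿ n a b = divides (geometricSum n a b)
  (trans (sym ([a-b]*geometricSum≡aⁿ-bⁿ n a b)) (ℤ.*-comm (a - b) (geometricSum n a b)))

a-b∣geometricSum-[1+m]bᵐ : ∀ m a b → (a - b) ∣ℤ geometricSum (suc m) a b - + suc m * b ^ m
a-b∣geometricSum-[1+m]bᵐ zero    a b = divides (+ 0) (vanish a b)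
  where
  vanish : ∀ a b → + 1 + b * + 0 - + 1 * + 1 ≡ + 0 * (a - b)
  vanish = solve-∀
a-b∣geometricSum-[1+m]bᵐ (suc m) a b =
  subst ((a - b) ∣ℤ_) (regroup a b (a ^ suc m) (b ^ m) (geometricSum (suc m) a b) (+ m))
    (ℤ∣.∣m∣n⇒∣m+n (a-b∣aⁿ-bⁿ (suc m) a b) (ℤ∣.∣n⇒∣m*n b (a-b∣geometricSum-[1+m]bᵐ m a b)))
  where
  regroup : ∀ a b A B g m → (A - b * B) + b * (g - (+ 1 + m) * B) ≡ (A + b * g) - (+ 1 + (+ 1 + m)) * (b * B)
  regroup = solve-∀

x²+y²+bⁿ≡aⁿ⇒x²+y²≡[a-b]*geometricSum : ∀ n x y a b →
  x ^ 2 + y ^ 2 + b ^ n ≡ a ^ n → x ^ 2 + y ^ 2 ≡ (a - b) * geometricSum n a b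
x²+y²+bⁿ≡aⁿ⇒x²+y²≡[a-b]*geometricSum n x y a b eq = begin
  x ^ 2 + y ^ 2                 ≡⟨ s≡[s+c]-c (x ^ 2 + y ^ 2) (b ^ n) ⟩
  x ^ 2 + y ^ 2 + b ^ n - b ^ n ≡⟨ cong (_- b ^ n) eq ⟩
  a ^ n - b ^ n                 ≡⟨ [a-b]*geometricSum≡aⁿ-bⁿ n a b ⟨
  (a - b) * geometricSum n a b  ∎
  where
  s≡[s+c]-c : ∀ s c → s ≡ s + c - c
  s≡[s+c]-c = solve-∀

-- Fermat's little theorem

prime∤1 : ∀ {q} → Prime q → ¬ q ∣ℕ 1
prime∤1 pq q∣1 = ¬prime[1] (subst Prime (∣1⇒≡1 q∣1) pq)

prime∣aⁿ⇒∣a : ∀ {q} → Prime q → ∀ a n → q ∣ℕ a ^ℕ n → q ∣ℕ a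
prime∣aⁿ⇒∣a pq a zero    q∣1 = contradiction q∣1 (prime∤1 pq)
prime∣aⁿ⇒∣a pq a (suc n) q∣aⁿ⁺¹ with euclidsLemma a (a ^ℕ n) pq q∣aⁿ⁺¹
... | inj₁ q∣a  = q∣a
... | inj₂ q∣aⁿ = prime∣aⁿ⇒∣a pq a n q∣aⁿ

prime∤m! : ∀ {q} → Prime q → ∀ {m} → m < q → ¬ q ∣ℕ m !
prime∤m! pq {zero}  _   = prime∤1 pq
prime∤m! pq {suc m} m<q q∣m! with euclidsLemma (suc m) (m !) pq q∣m!
... | inj₁ q∣1+m = ℕ.<⇒≱ m<q (∣⇒≤ q∣1+m)
... | inj₂ q∣m!  = prime∤m! pq (ℕ.<-trans (ℕ.n<1+n m) m<q) q∣m!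

prime∣qCj : ∀ {q j} → Prime q → 0 < j → j < q → q ∣ℕ q C j
prime∣qCj {q@(suc q-1)} {j} pq 0<j j<q with euclidsLemma (j ! *ℕ (q ∸ j) !) (q C j) pq q∣q!
  where
  j≤q = ℕ.<⇒≤ j<q
  q!≡ : (j ! *ℕ (q ∸ j) !) *ℕ (q C j) ≡ q !
  q!≡ = trans (cong ((j ! *ℕ (q ∸ j) !) *ℕ_) (nCk≡n!/k![n-k]! j≤q))
              (m*[n/m]≡n {{ℕ._!*_!≢0 j (q ∸ j)}} (k![n∸k]!∣n! j≤q))
  q∣q! : q ∣ℕ (j ! *ℕ (q ∸ j) !) *ℕ (q C j)
  q∣q! = subst (q ∣ℕ_) (sym q!≡) (m∣m*n (q-1 !))
... | inj₂ q∣qCj = q∣qCj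
... | inj₁ q∣j![q-j]! with euclidsLemma (j !) ((q ∸ j) !) pq q∣j![q-j]!
...   | inj₁ q∣j!     = contradiction q∣j! (prime∤m! pq j<q)
...   | inj₂ q∣[q-j]! = contradiction q∣[q-j]! (prime∤m! pq (ℕ.∸-monoʳ-< 0<j (ℕ.<⇒≤ j<q)))

-- The library's binomial theorem is phrased with the semiring's own power and
-- n-fold sum, which agree with ℕ's _^_ and _*_ only propositionally.
^ˢ≡^ : ∀ a n → a ^ˢ n ≡ a ^ℕ n
^ˢ≡^ a zero    = refl
^ˢ≡^ a (suc n) = cong (a *ℕ_) (^ˢ≡^ a n)

×ₘ≡* : ∀ m a → m ×ₘ a ≡ m *ℕ a
×ₘ≡* zero    a = refl
×ₘ≡* (suc m) a = cong (a +ℕ_) (×ₘ≡* m a)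

∣-sum : ∀ {d n} (t : Vector ℕ n) → (∀ i → d ∣ℕ t i) → d ∣ℕ sum t
∣-sum {n = zero}  t d∣t = _ ∣0
∣-sum {n = suc n} t d∣t = ∣m∣n⇒∣m+n (d∣t zero) (∣-sum (tail t) (d∣t ∘ suc))

binomialTerm[a,1]≡ : ∀ a n k → binomialTerm a 1 n k ≡ (n C toℕ k) *ℕ a ^ℕ toℕ k
binomialTerm[a,1]≡ a n k = begin
  (n C i) ×ₘ (a ^ˢ i *ℕ 1 ^ˢ (n ∸ i)) ≡⟨ ×ₘ≡* (n C i) _ ⟩
  (n C i) *ℕ (a ^ˢ i *ℕ 1 ^ˢ (n ∸ i)) ≡⟨ cong ((n C i) *ℕ_) (cong₂ _*ℕ_ (^ˢ≡^ a i) 1ⁿ≡1) ⟩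
  (n C i) *ℕ (a ^ℕ i *ℕ 1)            ≡⟨ cong ((n C i) *ℕ_) (ℕ.*-identityʳ (a ^ℕ i)) ⟩
  (n C i) *ℕ a ^ℕ i                   ∎
  where
  i = toℕ k
  1ⁿ≡1 = trans (^ˢ≡^ 1 (n ∸ i)) (ℕ.^-zeroˡ (n ∸ i))

binomial[1+a]ⁿ⁺¹ : ∀ n a →
  suc a ^ℕ suc n ≡ suc (sum (λ (i : Fin n) → (suc n C suc (toℕ i)) *ℕ a ^ℕ suc (toℕ i)) +ℕ a ^ℕ suc n)
binomial[1+a]ⁿ⁺¹ n a = begin
  suc a ^ℕ q                 ≡⟨ cong (_^ℕ q) (ℕ.+-comm 1 a) ⟩
  (a +ℕ 1) ^ℕ q              ≡⟨ sym (^ˢ≡^ (a +ℕ 1) q) ⟩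
  (a +ℕ 1) ^ˢ q              ≡⟨ theorem q a 1 ⟩
  t zero +ℕ sum (tail t)     ≡⟨ cong (t zero +ℕ_) (sum-init-last (tail t)) ⟩
  t zero +ℕ (sum (t ∘ suc ∘ inject₁) +ℕ t (suc (fromℕ n)))
    ≡⟨ cong₂ (λ s l → t zero +ℕ (s +ℕ l)) (sum-cong-≗ inner) last ⟩
  t zero +ℕ (sum middle +ℕ a ^ℕ q) ≡⟨ cong (_+ℕ (sum middle +ℕ a ^ℕ q)) (binomialTerm[a,1]≡ a q zero) ⟩
  suc (sum middle +ℕ a ^ℕ q) ∎
  where
  q = suc n
  t = binomialTerm a 1 q
  middle : Fin n → ℕ
  middle i = (q C suc (toℕ i)) *ℕ a ^ℕ suc (toℕ i)
  inner : ∀ i → t (suc (inject₁ i)) ≡ middle i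
  inner i = trans (binomialTerm[a,1]≡ a q (suc (inject₁ i)))
                  (cong (λ j → (q C suc j) *ℕ a ^ℕ suc j) (toℕ-inject₁ i))
  last : t (suc (fromℕ n)) ≡ a ^ℕ q
  last = begin
    t (suc (fromℕ n))                             ≡⟨ binomialTerm[a,1]≡ a q (suc (fromℕ n)) ⟩
    (q C suc (toℕ (fromℕ n))) *ℕ a ^ℕ suc (toℕ (fromℕ n)) ≡⟨ cong (λ j → (q C suc j) *ℕ a ^ℕ suc j) (toℕ-fromℕ n) ⟩
    (q C q) *ℕ a ^ℕ q                             ≡⟨ cong (_*ℕ a ^ℕ q) (nCn≡1 q) ⟩
    1 *ℕ a ^ℕ q                                   ≡⟨ ℕ.*-identityˡ (a ^ℕ q) ⟩
    a ^ℕ q                                        ∎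

freshmansDream : ∀ {q} → Prime q → ∀ a → ∃[ c ] suc a ^ℕ q ≡ suc (c *ℕ q +ℕ a ^ℕ q)
freshmansDream {suc n} pq a
  with ∣-sum _ (λ i → ∣m⇒∣m*n (a ^ℕ suc (toℕ i)) (prime∣qCj pq z<s (s<s (toℕ<n i))))
... | divides c middle≡c*q = c , trans (binomial[1+a]ⁿ⁺¹ n a) (cong (λ m → suc (m +ℕ a ^ℕ suc n)) middle≡c*q)

fermatsLittleTheorem : ∀ {q} → Prime q → ∀ a → ∃[ m ] a ^ℕ q ≡ a +ℕ m *ℕ q
fermatsLittleTheorem {suc n} pq zero = 0 , refl
fermatsLittleTheorem {q}     pq (suc a) with freshmansDream pq a | fermatsLittleTheorem pq a
... | c , [1+a]ᵠ≡ | m , aᵠ≡ = c +ℕ m , (begin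
  suc a ^ℕ q                   ≡⟨ [1+a]ᵠ≡ ⟩
  suc (c *ℕ q +ℕ a ^ℕ q)       ≡⟨ cong (λ t → suc (c *ℕ q +ℕ t)) aᵠ≡ ⟩
  suc (c *ℕ q +ℕ (a +ℕ m *ℕ q)) ≡⟨ cong suc (regroup c m q a) ⟩
  suc a +ℕ (c +ℕ m) *ℕ q       ∎)
  where
  regroup : ∀ c m q a → c *ℕ q +ℕ (a +ℕ m *ℕ q) ≡ a +ℕ (c +ℕ m) *ℕ q
  regroup = ℕ-Solver.solve-∀

-- Sums of two squares

prime∣aᵠ⁺¹-a² : ∀ {q} → Prime q → ∀ a → + q ∣ℤ (+ a) ^ suc q - (+ a) ^ 2
prime∣aᵠ⁺¹-a² {q} pq a with fermatsLittleTheorem pq a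
... | m , aᵠ≡ = divides (+ a * + m) (begin
  + a * (+ a) ^ q - (+ a) ^ 2                   ≡⟨ cong (λ t → + a * t - (+ a) ^ 2) (sym (pos-^ a q)) ⟩
  + a * + (a ^ℕ q) - (+ a) ^ 2                  ≡⟨ cong (λ t → + a * + t - (+ a) ^ 2) aᵠ≡ ⟩
  + a * + (a +ℕ m *ℕ q) - (+ a) ^ 2             ≡⟨ cong (λ t → + a * t - (+ a) ^ 2) (trans (ℤ.pos-+ a (m *ℕ q)) (cong (λ t → + a + t) (ℤ.pos-* m q))) ⟩
  + a * (+ a + + m * + q) - + a * (+ a * + 1)   ≡⟨ expand (+ a) (+ m) (+ q) ⟩
  + a * + m * + q                               ∎)
  where
  expand : ∀ a m q → a * (a + m * q) - a * (a * + 1) ≡ a * m * q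
  expand = solve-∀

prime>2∣2a²⇒∣a : ∀ {q} → Prime q → 2 < q → ∀ a → q ∣ℕ 2 *ℕ a ^ℕ 2 → q ∣ℕ a
prime>2∣2a²⇒∣a pq 2<q a q∣2a² with euclidsLemma 2 (a ^ℕ 2) pq q∣2a²
... | inj₁ q∣2  = contradiction (∣⇒≤ q∣2) (ℕ.<⇒≱ 2<q)
... | inj₂ q∣a² = prime∣aⁿ⇒∣a pq a 2 q∣a²

-- Write q + 1 = 4(m + 1). By Fermat x^(q+1) ≡ x² (mod q), while x² + y² divides
-- x⁴ − y⁴ and hence x^(q+1) − y^(q+1); so x² ≡ y² and x² ≡ −y², giving q ∣ 2x².
prime≡3mod4∣X²+Y²⇒∣X : ∀ {q} → Prime q → q % 4 ≡ 3 → ∀ X Y → q ∣ℕ X ^ℕ 2 +ℕ Y ^ℕ 2 → q ∣ℕ X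
prime≡3mod4∣X²+Y²⇒∣X {q} pq q%4≡3 X Y q∣X²+Y² =
  prime>2∣2a²⇒∣a pq 2<q X (subst (q ∣ℕ_) ∣2x²∣≡2X² (∣⇒∣ᵤ q∣2x²))
  where
  x = + X
  y = + Y
  m = q / 4
  q≡3+m*4 : q ≡ 3 +ℕ m *ℕ 4
  q≡3+m*4 = trans (m≡m%n+[m/n]*n q 4) (cong (_+ℕ m *ℕ 4) q%4≡3)
  q+1≡4[m+1] : suc q ≡ 4 *ℕ suc m
  q+1≡4[m+1] = trans (cong suc q≡3+m*4) (ℕ.*-comm (suc m) 4)
  ^4-as-power : ∀ z → (z ^ 4) ^ suc m ≡ z ^ suc q
  ^4-as-power z = trans (ℤ.^-*-assoc z 4 (suc m)) (cong (z ^_) (sym q+1≡4[m+1]))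
  q∣x²+y² : + q ∣ℤ x ^ 2 + y ^ 2
  q∣x²+y² = subst (+ q ∣ℤ_) (trans (ℤ.pos-+ (X ^ℕ 2) (Y ^ℕ 2)) (cong₂ _+_ (pos-^ X 2) (pos-^ Y 2))) (∣ᵤ⇒∣ q∣X²+Y²)
  q∣x⁴-y⁴ : + q ∣ℤ x ^ 4 - y ^ 4
  q∣x⁴-y⁴ = subst (+ q ∣ℤ_) (trans (difference-of-squares (x ^ 2) (y ^ 2)) (sym (cong₂ _-_ (ℤ.^-distribˡ-+-* x 2 2) (ℤ.^-distribˡ-+-* y 2 2))))
    (ℤ∣.∣m⇒∣m*n (x ^ 2 - y ^ 2) q∣x²+y²)
    where
    difference-of-squares : ∀ u v → (u + v) * (u - v) ≡ u * u - v * v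
    difference-of-squares = solve-∀
  q∣xᵠ⁺¹-yᵠ⁺¹ : + q ∣ℤ x ^ suc q - y ^ suc q
  q∣xᵠ⁺¹-yᵠ⁺¹ = subst (+ q ∣ℤ_) (cong₂ _-_ (^4-as-power x) (^4-as-power y))
    (ℤ∣.∣-trans q∣x⁴-y⁴ (a-b∣aⁿ-bⁿ (suc m) (x ^ 4) (y ^ 4)))
  q∣2x² : + q ∣ℤ + 2 * x ^ 2
  q∣2x² = subst (+ q ∣ℤ_) (combine (x ^ 2) (y ^ 2) (x ^ suc q) (y ^ suc q))
    (ℤ∣.∣m∣n⇒∣m+n q∣x²+y² (ℤ∣.∣m∣n⇒∣m+n (ℤ∣.∣m∣n⇒∣m-n q∣xᵠ⁺¹-yᵠ⁺¹ (prime∣aᵠ⁺¹-a² pq X)) (prime∣aᵠ⁺¹-a² pq Y)))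
    where
    combine : ∀ u v A B → (u + v) + (((A - B) - (A - u)) + (B - v)) ≡ + 2 * u
    combine = solve-∀
  ∣2x²∣≡2X² : ∣ + 2 * x ^ 2 ∣ ≡ 2 *ℕ X ^ℕ 2
  ∣2x²∣≡2X² = trans (ℤ.abs-* (+ 2) (x ^ 2)) (cong (λ t → 2 *ℕ ∣ t ∣) (sym (pos-^ X 2)))
  2<q : 2 < q
  2<q = subst (2 <_) (sym q≡3+m*4) (ℕ.m≤m+n 3 (m *ℕ 4))

prime≡3mod4∣X²+Y²⇒∣X∧∣Y : ∀ {q} → Prime q → q % 4 ≡ 3 → ∀ X Y → q ∣ℕ X ^ℕ 2 +ℕ Y ^ℕ 2 → q ∣ℕ X × q ∣ℕ Y
prime≡3mod4∣X²+Y²⇒∣X∧∣Y {q} pq q%4≡3 X Y q∣X²+Y² =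
  prime≡3mod4∣X²+Y²⇒∣X pq q%4≡3 X Y q∣X²+Y² ,
  prime≡3mod4∣X²+Y²⇒∣X pq q%4≡3 Y X (subst (q ∣ℕ_) (ℕ.+-comm (X ^ℕ 2) (Y ^ℕ 2)) q∣X²+Y²)

residue-*≡3 : ∀ {r s} → r < 4 → s < 4 → (r *ℕ s) % 4 ≡ 3 → r ≡ 3 ⊎ s ≡ 3
residue-*≡3 {3}     _ _ _ = inj₁ refl
residue-*≡3 {_} {3} _ _ _ = inj₂ refl
residue-*≡3 {0} {0} _ _ ()
residue-*≡3 {0} {1} _ _ ()
residue-*≡3 {0} {2} _ _ ()
residue-*≡3 {1} {0} _ _ ()
residue-*≡3 {1} {1} _ _ ()
residue-*≡3 {1} {2} _ _ ()
residue-*≡3 {2} {0} _ _ ()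
residue-*≡3 {2} {1} _ _ ()
residue-*≡3 {2} {2} _ _ ()
residue-*≡3 {suc (suc (suc (suc _)))} (s≤s (s≤s (s≤s (s≤s ())))) _ _
residue-*≡3 {_} {suc (suc (suc (suc _)))} _ (s≤s (s≤s (s≤s (s≤s ())))) _

[m*n]%4≡3⇒m%4≡3⊎n%4≡3 : ∀ m n → (m *ℕ n) % 4 ≡ 3 → m % 4 ≡ 3 ⊎ n % 4 ≡ 3
[m*n]%4≡3⇒m%4≡3⊎n%4≡3 m n mn%4≡3 =
  residue-*≡3 (m%n<n m 4) (m%n<n n 4) (trans (sym (%-distribˡ-* m n 4)) mn%4≡3)

n%4≡3⇒[n*n]%4≡1 : ∀ n → n % 4 ≡ 3 → (n *ℕ n) % 4 ≡ 1
n%4≡3⇒[n*n]%4≡1 n n%4≡3 = trans (%-distribˡ-* n n 4) (cong (λ r → (r *ℕ r) % 4) n%4≡3)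

[m*n]%d≡m%d : ∀ m n d .{{_ : NonZero d}} → n % d ≡ 1 → (m *ℕ n) % d ≡ m % d
[m*n]%d≡m%d m n d n%d≡1 = begin
  (m *ℕ n) % d             ≡⟨ %-distribˡ-* m n d ⟩
  ((m % d) *ℕ (n % d)) % d ≡⟨ cong (λ r → ((m % d) *ℕ r) % d) n%d≡1 ⟩
  ((m % d) *ℕ 1) % d       ≡⟨ cong (_% d) (ℕ.*-identityʳ (m % d)) ⟩
  m % d % d                ≡⟨ m%n%n≡m%n m d ⟩
  m % d                    ∎

PrimeFactor≡3mod4 : ℕ → Set
PrimeFactor≡3mod4 n = ∃[ q ] Prime q × q % 4 ≡ 3 × q ∣ℕ n

primeFactor≡3mod4-product : ∀ {ps} → All Prime ps → product ps % 4 ≡ 3 → PrimeFactor≡3mod4 (product ps)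
primeFactor≡3mod4-product {p ∷ ps} (pp ∷ pps) ∏%4≡3 with [m*n]%4≡3⇒m%4≡3⊎n%4≡3 p (product ps) ∏%4≡3
... | inj₁ p%4≡3 = p , pp , p%4≡3 , m∣m*n (product ps)
... | inj₂ ∏ps%4≡3 with primeFactor≡3mod4-product pps ∏ps%4≡3
...   | q , pq , q%4≡3 , q∣∏ps = q , pq , q%4≡3 , ∣-trans q∣∏ps (n∣m*n p)

primeFactor≡3mod4 : ∀ n → n % 4 ≡ 3 → PrimeFactor≡3mod4 n
primeFactor≡3mod4 n@(suc _) n%4≡3 =
  subst PrimeFactor≡3mod4 (sym isFactorisation)
    (primeFactor≡3mod4-product factorsPrime (subst (λ m → m % 4 ≡ 3) isFactorisation n%4≡3))
  where open PrimeFactorisation (factorise n)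

cancel-q : ∀ q .{{_ : NonZero q}} X Y D M →
  (X *ℕ q) ^ℕ 2 +ℕ (Y *ℕ q) ^ℕ 2 ≡ (D *ℕ q) *ℕ M → q *ℕ (X ^ℕ 2 +ℕ Y ^ℕ 2) ≡ D *ℕ M
cancel-q q X Y D M eq = ℕ.*-cancelˡ-≡ _ _ q (begin
  q *ℕ (q *ℕ (X ^ℕ 2 +ℕ Y ^ℕ 2)) ≡⟨ scale X Y q ⟩
  (X *ℕ q) ^ℕ 2 +ℕ (Y *ℕ q) ^ℕ 2 ≡⟨ eq ⟩
  (D *ℕ q) *ℕ M                  ≡⟨ xy∙z≈y∙xz D q M ⟩
  q *ℕ (D *ℕ M)                  ∎)
  where
  -- squares written out, since the ring solver does not normalise _^_
  scale : ∀ X Y q → q *ℕ (q *ℕ (X *ℕ (X *ℕ 1) +ℕ Y *ℕ (Y *ℕ 1)))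
                  ≡ (X *ℕ q) *ℕ ((X *ℕ q) *ℕ 1) +ℕ (Y *ℕ q) *ℕ ((Y *ℕ q) *ℕ 1)
  scale = ℕ-Solver.solve-∀

divideOut-q² : ∀ {q} → Prime q → ∀ {X Y D M} → q ∣ℕ X → q ∣ℕ Y → q ∣ℕ D → X ^ℕ 2 +ℕ Y ^ℕ 2 ≡ D *ℕ M →
  q ∣ℕ M ⊎ ∃[ D′ ] D ≡ D′ *ℕ q *ℕ q × ∃[ X′ ] ∃[ Y′ ] X′ ^ℕ 2 +ℕ Y′ ^ℕ 2 ≡ D′ *ℕ M
divideOut-q² {q} pq {M = M} (divides X′ refl) (divides Y′ refl) (divides D₁ refl) eq =
  [ inj₂ ∘ divideOut , inj₁ ]′ (euclidsLemma D₁ M pq q∣D₁M)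
  where
  instance _ = prime⇒nonZero pq
  qS≡D₁M = cancel-q q X′ Y′ D₁ M eq
  q∣D₁M : q ∣ℕ D₁ *ℕ M
  q∣D₁M = divides (X′ ^ℕ 2 +ℕ Y′ ^ℕ 2) (trans (sym qS≡D₁M) (ℕ.*-comm q _))
  divideOut : q ∣ℕ D₁ → ∃[ D′ ] D₁ *ℕ q ≡ D′ *ℕ q *ℕ q × ∃[ X′ ] ∃[ Y′ ] X′ ^ℕ 2 +ℕ Y′ ^ℕ 2 ≡ D′ *ℕ M
  divideOut (divides D′ D₁≡D′q) = D′ , cong (_*ℕ q) D₁≡D′q , X′ , Y′ ,
    ℕ.*-cancelˡ-≡ _ _ q (trans qS≡D₁M (trans (cong (_*ℕ M) D₁≡D′q) (xy∙z≈y∙xz D′ q M)))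

%4≡3⇒nonZero : ∀ {n} → n % 4 ≡ 3 → NonZero n
%4≡3⇒nonZero {suc n} _ = _

prime⇒1<q : ∀ {q} → Prime q → 1 < q
prime⇒1<q {q} pq = nonTrivial⇒n>1 q {{prime⇒nonTrivial pq}}

m<m*q*q : ∀ m q .{{_ : NonZero m}} → 1 < q → m < m *ℕ q *ℕ q
m<m*q*q m q@(suc _) 1<q = ℕ.<-≤-trans (ℕ.m<m*n m q 1<q) (ℕ.m≤m*n (m *ℕ q) q)

CommonPrime≡3mod4 : ℕ → ℕ → Set
CommonPrime≡3mod4 m n = ∃[ q ] Prime q × q % 4 ≡ 3 × q ∣ℕ m × q ∣ℕ n

X²+Y²≡D*M⇒commonPrime≡3mod4 : ∀ D X Y M → X ^ℕ 2 +ℕ Y ^ℕ 2 ≡ D *ℕ M → D % 4 ≡ 3 → CommonPrime≡3mod4 D M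
X²+Y²≡D*M⇒commonPrime≡3mod4 = <-rec P descend
  where
  P : ℕ → Set
  P D = ∀ X Y M → X ^ℕ 2 +ℕ Y ^ℕ 2 ≡ D *ℕ M → D % 4 ≡ 3 → CommonPrime≡3mod4 D M
  descend : ∀ D → (∀ {D′} → D′ < D → P D′) → P D
  descend D rec X Y M eq D%4≡3 with primeFactor≡3mod4 D D%4≡3
  ... | q , pq , q%4≡3 , q∣D = [ q∣M⇒common , recurse ]′ (divideOut-q² pq q∣X q∣Y q∣D eq)
    where
    q∣X×q∣Y = prime≡3mod4∣X²+Y²⇒∣X∧∣Y pq q%4≡3 X Y (subst (q ∣ℕ_) (sym eq) (∣m⇒∣m*n M q∣D))
    q∣X = proj₁ q∣X×q∣Y
    q∣Y = proj₂ q∣X×q∣Y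
    q∣M⇒common : q ∣ℕ M → CommonPrime≡3mod4 D M
    q∣M⇒common q∣M = q , pq , q%4≡3 , q∣D , q∣M
    recurse : ∃[ D′ ] D ≡ D′ *ℕ q *ℕ q × ∃[ X′ ] ∃[ Y′ ] X′ ^ℕ 2 +ℕ Y′ ^ℕ 2 ≡ D′ *ℕ M → CommonPrime≡3mod4 D M
    recurse (D′ , D≡D′qq , X′ , Y′ , eq′) with rec D′<D X′ Y′ M eq′ D′%4≡3
      where
      D′%4≡3 : D′ % 4 ≡ 3
      D′%4≡3 = trans (sym ([m*n]%d≡m%d D′ (q *ℕ q) 4 (n%4≡3⇒[n*n]%4≡1 q q%4≡3)))
                     (trans (cong (_% 4) (trans (sym (ℕ.*-assoc D′ q q)) (sym D≡D′qq))) D%4≡3)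
      D′<D : D′ < D
      D′<D = subst (D′ <_) (sym D≡D′qq) (m<m*q*q D′ q {{%4≡3⇒nonZero D′%4≡3}} (prime⇒1<q pq))
    ... | q′ , pq′ , q′%4≡3 , q′∣D′ , q′∣M =
      q′ , pq′ , q′%4≡3 , ∣-trans q′∣D′ (subst (D′ ∣ℕ_) (sym D≡D′qq) (∣-trans (m∣m*n q) (m∣m*n q))) , q′∣M

-- Congruences

i-j≡k⇒i≡j+k : ∀ {i j k} → i - j ≡ k → i ≡ j + k
i-j≡k⇒i≡j+k {i} {j} {k} i-j≡k = trans (i≡j+[i-j] i j) (cong (λ t → j + t) i-j≡k)
  where
  i≡j+[i-j] : ∀ i j → i ≡ j + (i - j)
  i≡j+[i-j] = solve-∀

d∣n-r⇒n%d≡r : ∀ {d n r} .{{_ : NonZero d}} → + d ∣ℤ + n - + r → r < d → n % d ≡ r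
d∣n-r⇒n%d≡r {d} {n} {r} (divides (+ w) n-r≡wd) r<d = begin
  n % d              ≡⟨ cong (_% d) (ℤ.+-injective n≡r+wd) ⟩
  (r +ℕ w *ℕ d) % d  ≡⟨ [m+kn]%n≡m%n r w d ⟩
  r % d              ≡⟨ m<n⇒m%n≡m r<d ⟩
  r                  ∎
  where
  n≡r+wd : + n ≡ + (r +ℕ w *ℕ d)
  n≡r+wd = begin
    + n                 ≡⟨ i-j≡k⇒i≡j+k {+ n} {+ r} n-r≡wd ⟩
    + r + + w * + d     ≡⟨ cong (λ t → + r + t) (ℤ.pos-* w d) ⟨
    + r + + (w *ℕ d)    ≡⟨ ℤ.pos-+ r (w *ℕ d) ⟨
    + (r +ℕ w *ℕ d)     ∎
d∣n-r⇒n%d≡r {d} {n} {r} (divides -[1+ w ] n-r≡-[1+w]d) r<d =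
  contradiction (subst (d ≤_) n+[1+w]d≡r (ℕ.≤-trans (ℕ.m≤n*m d (suc w)) (ℕ.m≤n+m _ n))) (ℕ.<⇒≱ r<d)
  where
  n+[1+w]d≡r : n +ℕ suc w *ℕ d ≡ r
  n+[1+w]d≡r = ℤ.+-injective (begin
    + (n +ℕ suc w *ℕ d)                   ≡⟨ trans (ℤ.pos-+ n _) (cong (λ t → + n + t) (ℤ.pos-* (suc w) d)) ⟩
    + n + + suc w * + d                   ≡⟨ cong (λ t → t + + suc w * + d) (i-j≡k⇒i≡j+k {+ n} {+ r} n-r≡-[1+w]d) ⟩
    + r + - (+ suc w) * + d + + suc w * + d ≡⟨ cancel (+ r) (+ suc w) (+ d) ⟩
    + r                                   ∎)
    where
    cancel : ∀ r s d → r + - s * d + s * d ≡ r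
    cancel = solve-∀

k%2≡1⇒4∣2k+2 : ∀ k → k % 2 ≡ 1 → 4 ∣ℕ 2 *ℕ k +ℕ 2
k%2≡1⇒4∣2k+2 k k%2≡1 = divides (k / 2 +ℕ 1) (begin
  2 *ℕ k +ℕ 2                         ≡⟨ cong (λ n → 2 *ℕ n +ℕ 2) (trans (m≡m%n+[m/n]*n k 2) (cong (_+ℕ (k / 2) *ℕ 2) k%2≡1)) ⟩
  2 *ℕ (1 +ℕ (k / 2) *ℕ 2) +ℕ 2       ≡⟨ double (k / 2) ⟩
  (k / 2 +ℕ 1) *ℕ 4                   ∎)
  where
  double : ∀ j → 2 *ℕ (1 +ℕ j *ℕ 2) +ℕ 2 ≡ (j +ℕ 1) *ℕ 4
  double = ℕ-Solver.solve-∀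

a-b≡3mod4 : ∀ k a b → k % 2 ≡ 1 → + (4 *ℕ k) ∣ℤ a - + 1 → + (4 *ℕ k) ∣ℤ b - + (2 *ℕ k) → + 4 ∣ℤ (a - b) - + 3
a-b≡3mod4 k a b k%2≡1 4k∣a-1 4k∣b-2k = subst (+ 4 ∣ℤ_) (regroup a b (+ (2 *ℕ k)))
  (ℤ∣.∣m∣n⇒∣m-n (ℤ∣.∣m∣n⇒∣m-n (ℤ∣.∣-trans 4∣4k 4k∣a-1) (ℤ∣.∣-trans 4∣4k 4k∣b-2k)) 4∣2k+2)
  where
  4∣4k : + 4 ∣ℤ + (4 *ℕ k)
  4∣4k = ∣ᵤ⇒∣ (m∣m*n k)
  4∣2k+2 : + 4 ∣ℤ + (2 *ℕ k) + + 2
  4∣2k+2 = subst (+ 4 ∣ℤ_) (ℤ.pos-+ (2 *ℕ k) 2) (∣ᵤ⇒∣ (k%2≡1⇒4∣2k+2 k k%2≡1))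
  regroup : ∀ a b c → (a - + 1) - (b - c) - (c + + 2) ≡ (a - b) - + 3
  regroup = solve-∀

a-b≡1modk : ∀ k a b → + (4 *ℕ k) ∣ℤ a - + 1 → + (4 *ℕ k) ∣ℤ b - + (2 *ℕ k) → + k ∣ℤ (a - b) - + 1
a-b≡1modk k a b 4k∣a-1 4k∣b-2k = subst (+ k ∣ℤ_) (regroup a b (+ (2 *ℕ k)))
  (ℤ∣.∣m∣n⇒∣m-n (ℤ∣.∣m∣n⇒∣m-n (ℤ∣.∣-trans k∣4k 4k∣a-1) (ℤ∣.∣-trans k∣4k 4k∣b-2k)) (∣ᵤ⇒∣ (n∣m*n 2)))
  where
  k∣4k : + k ∣ℤ + (4 *ℕ k)
  k∣4k = ∣ᵤ⇒∣ (n∣m*n 4)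
  regroup : ∀ a b c → (a - + 1) - (b - c) - c ≡ (a - b) - + 1
  regroup = solve-∀

-- The equation x² + y² + zᵏ = pᵏ

prime∣a-b∧geometricSum⇒∣n⊎∣b : ∀ {q} → Prime q → ∀ m a b →
  + q ∣ℤ a - b → + q ∣ℤ geometricSum (suc m) a b → q ∣ℕ suc m ⊎ + q ∣ℤ b
prime∣a-b∧geometricSum⇒∣n⊎∣b {q} pq m a b q∣a-b q∣G =
  map₂ q∣∣b∣ (euclidsLemma (suc m) ∣ b ^ m ∣ pq (subst (q ∣ℕ_) (ℤ.abs-* (+ suc m) (b ^ m)) (∣⇒∣ᵤ q∣[1+m]bᵐ)))
  where
  q∣[1+m]bᵐ : + q ∣ℤ + suc m * b ^ m
  q∣[1+m]bᵐ = subst (+ q ∣ℤ_) (g-[g-c]≡c (geometricSum (suc m) a b) (+ suc m * b ^ m))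
    (ℤ∣.∣m∣n⇒∣m-n q∣G (ℤ∣.∣-trans q∣a-b (a-b∣geometricSum-[1+m]bᵐ m a b)))
    where
    g-[g-c]≡c : ∀ g c → g - (g - c) ≡ c
    g-[g-c]≡c = solve-∀
  q∣∣b∣ : q ∣ℕ ∣ b ^ m ∣ → + q ∣ℤ b
  q∣∣b∣ q∣∣bᵐ∣ = ∣ᵤ⇒∣ (prime∣aⁿ⇒∣a pq ∣ b ∣ m (subst (q ∣ℕ_) (abs-^ b m) q∣∣bᵐ∣))

prime≡3mod4∤gcd[p-z,geometricSum] : ∀ {p q} → Prime p → p % 4 ≡ 1 → Prime q → q % 4 ≡ 3 → ∀ k' z →
  + suc k' ∣ℤ (+ p - z) - + 1 → + q ∣ℤ + p - z → ¬ + q ∣ℤ geometricSum (suc k') (+ p) z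
prime≡3mod4∤gcd[p-z,geometricSum] {p} {q} pp p%4≡1 pq q%4≡3 k' z k∣p-z-1 q∣p-z q∣G =
  [ q∤k , q∤z ]′ (prime∣a-b∧geometricSum⇒∣n⊎∣b pq k' (+ p) z q∣p-z q∣G)
  where
  q≢1 : q ≢ 1
  q≢1 q≡1 = ¬prime[1] (subst Prime q≡1 pq)
  q∤k : ¬ q ∣ℕ suc k'
  q∤k q∣k = prime∤1 pq (∣⇒∣ᵤ (subst (+ q ∣ℤ_) (d-[d-1]≡1 (+ p - z))
    (ℤ∣.∣m∣n⇒∣m-n q∣p-z (ℤ∣.∣-trans (∣ᵤ⇒∣ q∣k) k∣p-z-1))))
    where
    d-[d-1]≡1 : ∀ d → d - (d - + 1) ≡ + 1
    d-[d-1]≡1 = solve-∀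
  q≢p : q ≢ p
  q≢p q≡p = contradiction (trans (sym p%4≡1) (subst (λ n → n % 4 ≡ 3) q≡p q%4≡3)) λ ()
  q∤z : ¬ + q ∣ℤ z
  q∤z q∣z = [ q≢1 , q≢p ]′ (prime⇒irreducible pp (∣⇒∣ᵤ (subst (+ q ∣ℤ_) (a-b+b≡a (+ p) z) (ℤ∣.∣m∣n⇒∣m+n q∣p-z q∣z))))
    where
    a-b+b≡a : ∀ a b → a - b + b ≡ a
    a-b+b≡a = solve-∀

m+nᵏ≡pᵏ⇒n≤p : ∀ k .{{_ : NonZero k}} m n p → m +ℕ n ^ℕ k ≡ p ^ℕ k → n ≤ p
m+nᵏ≡pᵏ⇒n≤p k m n p eq = ℕ.≮⇒≥ λ p<n → ℕ.<⇒≱ (ℕ.^-monoˡ-< k p<n) (subst (n ^ℕ k ≤_) eq (ℕ.m≤n+m _ m))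

x²+y²+zᵏ≡pᵏ⇒p-z∈ℕ : ∀ k' x y z p → x ^ 2 + y ^ 2 + z ^ suc k' ≡ (+ p) ^ suc k' → ∃[ D ] + p - z ≡ + D
x²+y²+zᵏ≡pᵏ⇒p-z∈ℕ k' x y z p eq with + p - z in p-z≡d
... | + D      = D , refl
... | -[1+ n ] = contradiction (m+nᵏ≡pᵏ⇒n≤p k _ Z p (ℤ.+-injective (begin
  + (∣ x ∣ ^ℕ 2 +ℕ ∣ y ∣ ^ℕ 2 +ℕ Z ^ℕ k) ≡⟨ ℤ.pos-+ _ (Z ^ℕ k) ⟩
  + (∣ x ∣ ^ℕ 2 +ℕ ∣ y ∣ ^ℕ 2) + + (Z ^ℕ k) ≡⟨ cong₂ _+_ (+[∣x∣²+∣y∣²]≡x²+y² x y) (pos-^ Z k) ⟩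
  x ^ 2 + y ^ 2 + (+ Z) ^ k                ≡⟨ cong (λ t → x ^ 2 + y ^ 2 + t ^ k) z≡Z ⟨
  x ^ 2 + y ^ 2 + z ^ k                    ≡⟨ eq ⟩
  (+ p) ^ k                                ≡⟨ pos-^ p k ⟨
  + (p ^ℕ k)                               ∎)))
  (ℕ.<⇒≱ (ℕ.m<m+n p z<s))
  where
  k = suc k'
  Z = p +ℕ suc n
  z≡Z : z ≡ + Z
  z≡Z = begin
    z                 ≡⟨ z≡a-[a-z] (+ p) z ⟩
    + p - (+ p - z)   ≡⟨ cong (λ d → + p - d) p-z≡d ⟩
    + p + + suc n     ≡⟨ ℤ.pos-+ p (suc n) ⟨
    + Z               ∎
    where
    z≡a-[a-z] : ∀ a z → z ≡ a - (a - z)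
    z≡a-[a-z] = solve-∀

x²+y²+zᵏ≢pᵏ : ∀ {p} → Prime p → p % 4 ≡ 1 → ∀ k' x y z D → + p - z ≡ + D → D % 4 ≡ 3 →
  + suc k' ∣ℤ (+ p - z) - + 1 → ¬ x ^ 2 + y ^ 2 + z ^ suc k' ≡ (+ p) ^ suc k'
x²+y²+zᵏ≢pᵏ {p} pp p%4≡1 k' x y z D p-z≡D D%4≡3 k∣p-z-1 eq =
  noCommonPrime (X²+Y²≡D*M⇒commonPrime≡3mod4 D (∣ x ∣) (∣ y ∣) (∣ G ∣) ∣x∣²+∣y∣²≡D*∣G∣ D%4≡3)
  where
  G = geometricSum (suc k') (+ p) z
  ∣x∣²+∣y∣²≡D*∣G∣ : ∣ x ∣ ^ℕ 2 +ℕ ∣ y ∣ ^ℕ 2 ≡ D *ℕ ∣ G ∣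
  ∣x∣²+∣y∣²≡D*∣G∣ = begin
    ∣ + (∣ x ∣ ^ℕ 2 +ℕ ∣ y ∣ ^ℕ 2) ∣ ≡⟨ cong ∣_∣ (+[∣x∣²+∣y∣²]≡x²+y² x y) ⟩
    ∣ x ^ 2 + y ^ 2 ∣              ≡⟨ cong ∣_∣ (x²+y²+bⁿ≡aⁿ⇒x²+y²≡[a-b]*geometricSum (suc k') x y (+ p) z eq) ⟩
    ∣ (+ p - z) * G ∣              ≡⟨ cong (λ d → ∣ d * G ∣) p-z≡D ⟩
    ∣ + D * G ∣                    ≡⟨ ℤ.abs-* (+ D) G ⟩
    D *ℕ ∣ G ∣                     ∎
  noCommonPrime : ¬ CommonPrime≡3mod4 D ∣ G ∣
  noCommonPrime (q , pq , q%4≡3 , q∣D , q∣G) = prime≡3mod4∤gcd[p-z,geometricSum] pp p%4≡1 pq q%4≡3 k' z k∣p-z-1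
    (subst (+ q ∣ℤ_) (sym p-z≡D) (∣ᵤ⇒∣ q∣D)) (∣ᵤ⇒∣ q∣G)

theorem1 : (k p : ℕ) → k ≥ 3 → k % 2 ≡ 1 → Prime p → (+ (4 *ℕ k)) ∣ (+ p - + 1) →
             ¬ Σ ℤ (λ x → Σ ℤ (λ y → Σ ℤ (λ z →
                 ((x ^ 2) + (y ^ 2) + (z ^ k) ≡ (+ p) ^ k) × ((+ (4 *ℕ k)) ∣ (z - + (2 *ℕ k))))))
theorem1 k@(suc k') p _ k%2≡1 pp 4k∣p-1 (x , y , z , eq , 4k∣z-2k) =
  let D , p-z≡D = x²+y²+zᵏ≡pᵏ⇒p-z∈ℕ k' x y z p eq
      D%4≡3     = d∣n-r⇒n%d≡r {n = D} (subst (λ d → + 4 ∣ℤ d - + 3) p-z≡D 4∣p-z-3) (ℕ.n<1+n 3)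
  in x²+y²+zᵏ≢pᵏ pp p%4≡1 k' x y z D p-z≡D D%4≡3 (a-b≡1modk k (+ p) z 4k∣p-1′ 4k∣z-2k′) eq
  where
  4k∣p-1′ = ∣ᵤ⇒∣ 4k∣p-1
  4k∣z-2k′ = ∣ᵤ⇒∣ 4k∣z-2k
  4∣p-z-3 : + 4 ∣ℤ (+ p - z) - + 3
  4∣p-z-3 = a-b≡3mod4 k (+ p) z k%2≡1 4k∣p-1′ 4k∣z-2k′
  p%4≡1 : p % 4 ≡ 1
  p%4≡1 = d∣n-r⇒n%d≡r {n = p} (ℤ∣.∣-trans (∣ᵤ⇒∣ (m∣m*n k)) 4k∣p-1′) (s<s z<s)
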